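{- Let $\mathrm{id}\in S_n$ be the identity permutation and let $P,Q$ be standard Young tableaux of the same shape. Then $$\mathcal{P}(\mathrm{id}\to P,Q)=\begin{cases} t^{n(\lambda)}\prod_{i=1}^{|\lambda|}\alpha_{P^{(i)}/P^{(i-1)}}(q,t)&\text{if }P=Q\text{ has shape }\lambda,\\ 0&\text{otherwise.}\end{cases}$$
   Context: Partitions are identified with their Young diagrams in French convention ($\lambda$ = cells $(x,y)\in\mathbb{Z}_{>0}^2$ with $x\le\lambda_y$; $\lambda'$ the conjugate). For $c=(x,y)\in\lambda$: $a_\lambda(c)=\lambda_y-x$, $\ell_\lambda(c)=\lambda'_x-y$; $n(\lambda)=\sum_c\ell_\lambda(c)$, $n'(\lambda)=\sum_c a_\lambda(c)$; $n(\rho/\kappa)=n(\rho)-n(\kappa)$, $n'(\rho/\kappa)=n'(\rho)-n'(\kappa)$. $\kappa\lessdot\rho$ means $\kappa\subseteq\rho$ with $\rho/\kappa$ one cell; $\mathcal{U}(\lambda)=\{\nu:\lambda\lessdot\nu\}$, $\mathcal{D}(\lambda)=\{\mu:\mu\lessdot\lambda\}$, $\mathcal{D}^*(\lambda)=\mathcal{D}(\lambda)\cup\{\lambda\}$. For $\kappa\lessdot\rho$, $\mathcal{R}_{\rho/\kappa}$ (resp. $\mathcal{C}_{\rho/\kappa}$) = cells of $\kappa$ in the same row (resp. column) as $\rho/\kappa$. A standard Young tableau $T$ of shape $\lambda\vdash n$ is identified with the chain $\emptyset=T^{(0)}\lessdot\dots\lessdot T^{(n)}=\lambda$, $T^{(i)}$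 the shape of entries $\le i$. Local probabilities: with $[i,j]=1-q^it^j$, $\alpha_{\rho/\kappa}=\prod_{c\in\mathcal{R}_{\rho/\kappa}}\frac{[a_\kappa(c),\ell_\kappa(c)+1]}{[a_\rho(c),\ell_\rho(c)+1]}\prod_{c\in\mathcal{C}_{\rho/\kappa}}\frac{[a_\kappa(c)+1,\ell_\kappa(c)]}{[a_\rho(c)+1,\ell_\rho(c)]}$, $\beta=1/\alpha$. For $\mu\in\mathcal{D}(\lambda)$, $\nu\in\mathcal{U}(\lambda)$, $N=n(\nu/\lambda)-n(\lambda/\mu)$, $M=n'(\lambda/\mu)-n'(\nu/\lambda)$, $\gamma_{\nu/\lambda/\mu}=\frac{(1-q^Mt^N)(1-q^{M+1}t^{N-1})}{(1-q)(1-t)}$. Set $\mathcal{P}_\lambda(\lambda\to\nu)=t^{n(\nu/\lambda)}\alpha_{\nu/\lambda}$ and $\mathcal{P}_\lambda(\mu\to\nu)=t^{N-1}\alpha_{\nu/\lambda}\beta_{\lambda/\mu}/\gamma_{\nu/\lambda/\mu}$. Growths: for $\sigma\in S_n$, $A_\sigma$ is the $n\times n$ matrix with $1$ at (row $\sigma(j)$, column $j$), $0$ elsewhere. A growth associated with $\sigma$ labels each vertex $(i,j)$, $0\le i,j\le n$, by a partition $\Lambda_{ij}$ so that $\Lambda_{ij}\subseteq\Lambda_{i,j+1}$, $\Lambda_{ij}\subseteq\Lambda_{i+1,j}$, and $|\Lambda_{ij}|$ equals the number of $1$'s of $A_\sigma$ in positions $(i',j')$ with $i'\le i$, $j'\le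 j$. The chain $\Lambda_{0,n}\subseteq\dots\subseteq\Lambda_{n,n}$ defines the standard tableau $P(\Lambda)$ and $\Lambda_{n,0}\subseteq\dots\subseteq\Lambda_{n,n}$ defines $Q(\Lambda)$; write $\Lambda:\sigma\to P,Q$ if $P(\Lambda)=P$, $Q(\Lambda)=Q$. For each square $1\le i,j\le n$ with corners $\mu=\Lambda_{i-1,j-1}$, $\rho=\Lambda_{i-1,j}$, $\lambda=\Lambda_{i,j-1}$, $\nu=\Lambda_{ij}$: if $\rho=\lambda$ and $\nu\ne\lambda$, set $\mathcal{P}(\square)=\mathcal{P}_\lambda(\mu\to\nu)$; otherwise $\mathcal{P}(\square)=1$. $\mathcal{P}(\Lambda)=\prod_\square\mathcal{P}(\square)$ and $\mathcal{P}(\sigma\to P,Q)=\sum_{\Lambda:\sigma\to P,Q}\mathcal{P}(\Lambda)$. -}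

module Defs where

open import Data.Bool using (Bool; true; false; _∧_; not; if_then_else_)
open import Data.Nat as ℕ using (ℕ; zero; suc; _≤_; _<_; _∸_; _⊓_; _≤ᵇ_; _<ᵇ_; _≡ᵇ_)
open import Data.Integer as ℤ using (ℤ; +_; -[1+_])
open import Data.Rational as ℚ using (ℚ; 0ℚ; 1ℚ; _÷_; ≢-nonZero)
open import Data.Rational.Properties using () renaming (_≟_ to _≟ℚ_)
open import Data.List as List using (List; []; _∷_; [_]; map; concatMap; applyUpTo; filterᵇ; length; foldr; concat)
open import Data.Nat.ListAction using (sum)
open import Data.List.Relation.Unary.All using (All)
open import Data.List.Relation.Unary.Linked using (Linked)
import Data.List.Properties as ListP
open import Data.Vec as Vec using (Vec; lookup; tabulate)
import Data.Vec.Properties as VecP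
open import Data.Fin as Fin using (Fin; toℕ; inject₁; fromℕ)
open import Data.Product using (_×_; _,_; proj₁; proj₂)
open import Relation.Nullary using (¬_; does)
open import Relation.Binary.PropositionalEquality using (_≡_; _≢_)

-- Partitions: a partition λ is the list of its row lengths
-- λ₁ ≥ λ₂ ≥ … > 0 (French convention: row y is λ_y).

IsPartition : List ℕ → Set
IsPartition λ′ = All (λ r → 0 < r) λ′ × Linked ℕ._≥_ λ′

-- λ_y (1-indexed; 0 outside)
row : List ℕ → ℕ → ℕ
row []       _             = 0
row (r ∷ rs) zero          = 0
row (r ∷ rs) (suc zero)    = r
row (r ∷ rs) (suc (suc y)) = row rs (suc y)

conj : List ℕ → ℕ → ℕ
conj λ′ x = length (filterᵇ (λ r → x ≤ᵇ r) λ′)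

size : List ℕ → ℕ
size = sum

Cell : Set
Cell = ℕ × ℕ   -- (x , y) : column x, row y, both ≥ 1

cellsFrom : ℕ → List ℕ → List Cell
cellsFrom y []       = []
cellsFrom y (r ∷ rs) = map (λ x → (suc x , y)) (applyUpTo (λ i → i) r) List.++ cellsFrom (suc y) rs

cells : List ℕ → List Cell
cells = cellsFrom 1

arm : List ℕ → Cell → ℕ
arm λ′ (x , y) = row λ′ y ∸ x

leg : List ℕ → Cell → ℕ
leg λ′ (x , y) = conj λ′ x ∸ y

nfun : List ℕ → ℕ
nfun λ′ = sum (map (leg λ′) (cells λ′))

nfun′ : List ℕ → ℕ
nfun′ λ′ = sum (map (arm λ′) (cells λ′))

nskew : List ℕ → List ℕ → ℤ
nskew ρ κ = (+ nfun ρ) ℤ.- (+ nfun κ)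

nskew′ : List ℕ → List ℕ → ℤ
nskew′ ρ κ = (+ nfun′ ρ) ℤ.- (+ nfun′ κ)

_⊆ᴾ_ : List ℕ → List ℕ → Set
κ ⊆ᴾ ρ = ∀ y → row κ y ≤ row ρ y

_⋖_ : List ℕ → List ℕ → Set
κ ⋖ ρ = IsPartition κ × IsPartition ρ × κ ⊆ᴾ ρ × size ρ ≡ suc (size κ)

_⊆ᵇ_ : List ℕ → List ℕ → Bool
[]      ⊆ᵇ _       = true
(k ∷ κ) ⊆ᵇ []      = false
(k ∷ κ) ⊆ᵇ (r ∷ ρ) = (k ≤ᵇ r) ∧ (κ ⊆ᵇ ρ)

_==_ : List ℕ → List ℕ → Bool
κ == ρ = does (ListP.≡-dec ℕ._≟_ κ ρ)

-- the row y₀ (1-indexed) of the cell ρ/κ, for κ ⋖ ρ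
addedRow : List ℕ → List ℕ → ℕ
addedRow _       []      = 0
addedRow []      (r ∷ ρ) = 1
addedRow (k ∷ κ) (r ∷ ρ) = if k ≡ᵇ r then suc (addedRow κ ρ) else 1

addedCell : List ℕ → List ℕ → Cell
addedCell κ ρ = (row ρ (addedRow κ ρ) , addedRow κ ρ)

Rcells : List ℕ → List ℕ → List Cell
Rcells κ ρ = filterᵇ (λ c → proj₂ c ≡ᵇ proj₂ (addedCell κ ρ)) (cells κ)

Ccells : List ℕ → List ℕ → List Cell
Ccells κ ρ = filterᵇ (λ c → proj₁ c ≡ᵇ proj₁ (addedCell κ ρ)) (cells κ)

-- Arithmetic in ℚ (the rational functions are evaluated at q, t ∈ ℚ)

_⊘_ : ℚ → ℚ → ℚ     -- division (only ever used with nonzero divisor)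
x ⊘ y with y ≟ℚ 0ℚ
... | Relation.Nullary.yes _  = 0ℚ
... | Relation.Nullary.no y≢0 = _÷_ x y {{≢-nonZero y≢0}}

prodℚ : List ℚ → ℚ
prodℚ = foldr ℚ._*_ 1ℚ

sumℚ : List ℚ → ℚ
sumℚ = foldr ℚ._+_ 0ℚ

pow : ℚ → ℕ → ℚ
pow x zero    = 1ℚ
pow x (suc k) = x ℚ.* pow x k

zpow : ℚ → ℤ → ℚ
zpow x (+ k)    = pow x k
zpow x -[1+ k ] = 1ℚ ⊘ pow x (suc k)

br : ℚ → ℚ → ℕ → ℕ → ℚ
br q t i j = 1ℚ ℚ.- (pow q i ℚ.* pow t j)

alpha : ℚ → ℚ → List ℕ → List ℕ → ℚ   -- α_{ρ/κ}, arguments κ ρ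
alpha q t κ ρ =
  prodℚ (map (λ c → br q t (arm κ c) (suc (leg κ c)) ⊘ br q t (arm ρ c) (suc (leg ρ c))) (Rcells κ ρ))
  ℚ.* prodℚ (map (λ c → br q t (suc (arm κ c)) (leg κ c) ⊘ br q t (suc (arm ρ c)) (leg ρ c)) (Ccells κ ρ))

beta : ℚ → ℚ → List ℕ → List ℕ → ℚ
beta q t κ ρ = 1ℚ ⊘ alpha q t κ ρ

gamma : ℚ → ℚ → List ℕ → List ℕ → List ℕ → ℚ  -- γ_{ν/λ/μ}, arguments μ λ ν
gamma q t μ λ′ ν =
  ((1ℚ ℚ.- (zpow q M ℚ.* zpow t N)) ℚ.* (1ℚ ℚ.- (zpow q (M ℤ.+ ℤ.1ℤ) ℚ.* zpow t (N ℤ.- ℤ.1ℤ))))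
  ⊘ ((1ℚ ℚ.- q) ℚ.* (1ℚ ℚ.- t))
  where
  N = nskew ν λ′ ℤ.- nskew λ′ μ
  M = nskew′ λ′ μ ℤ.- nskew′ ν λ′

-- 𝒫_λ(μ → ν), arguments μ λ ν (μ = λ or μ ⋖ λ; λ ⋖ ν)
Pstep : ℚ → ℚ → List ℕ → List ℕ → List ℕ → ℚ
Pstep q t μ λ′ ν =
  if μ == λ′
  then zpow t (nskew ν λ′) ℚ.* alpha q t λ′ ν
  else (zpow t (N ℤ.- ℤ.1ℤ) ℚ.* alpha q t λ′ ν ℚ.* beta q t μ λ′) ⊘ gamma q t μ λ′ ν
  where
  N = nskew ν λ′ ℤ.- nskew λ′ μ

partsF : ℕ → ℕ → ℕ → List (List ℕ)   -- fuel, size, max part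
partsF zero    zero    _ = [ [] ]
partsF zero    (suc _) _ = []
partsF (suc f) zero    _ = [ [] ]
partsF (suc f) (suc m) b =
  concatMap (λ k → map (suc k ∷_) (partsF f (suc m ∸ suc k) (suc k))) (applyUpTo (λ i → i) (b ⊓ suc m))

partitions : ℕ → List (List ℕ)
partitions m = partsF m m m

choices : {A : Set} {m : ℕ} → Vec (List A) m → List (Vec A m)
choices Vec.[]         = [ Vec.[] ]
choices (xs Vec.∷ xss) = concatMap (λ x → map (x Vec.∷_) (choices xss)) xs

-- Standard Young tableaux as chains ∅ = T⁽⁰⁾ ⋖ … ⋖ T⁽ⁿ⁾

Chain : ℕ → Set
Chain n = Vec (List ℕ) (suc n)

IsSYT : {n : ℕ} → Chain n → Set
IsSYT {n} T = lookup T Fin.zero ≡ [] × (∀ (i : Fin n) → lookup T (inject₁ i) ⋖ lookup T (Fin.suc i))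

shape : {n : ℕ} → Chain n → List ℕ
shape {n} T = lookup T (fromℕ n)

-- permutations are given as functions on Fin n (column j ↦ row σ(j))
Perm : ℕ → Set
Perm n = Fin n → Fin n

idPerm : (n : ℕ) → Perm n
idPerm n i = i

-- number of 1's of A_σ in positions (i',j') with i' ≤ i, j' ≤ j
rank : {n : ℕ} → Perm n → Fin (suc n) → Fin (suc n) → ℕ
rank {n} σ i j = length (filterᵇ (λ k → (toℕ k <ᵇ toℕ j) ∧ (toℕ (σ k) <ᵇ toℕ i)) (Vec.toList (Vec.allFin n)))

-- Λ as an (n+1)×(n+1) array, entry (i , j) = Λ_{ij}
Grid : ℕ → Set
Grid n = Vec (Vec (List ℕ) (suc n)) (suc n)

entry : {n : ℕ} → Grid n → Fin (suc n) → Fin (suc n) → List ℕ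
entry g i j = lookup (lookup g i) j

allᵇ : {A : Set} → (A → Bool) → List A → Bool
allᵇ p = foldr (λ a b → p a ∧ b) true

finList : (n : ℕ) → List (Fin n)
finList n = Vec.toList (Vec.allFin n)

candidates : {n : ℕ} → Perm n → List (Grid n)
candidates σ = choices (tabulate (λ i → choices (tabulate (λ j → partitions (rank σ i j)))))

isGrowthᵇ : {n : ℕ} → Perm n → Grid n → Bool
isGrowthᵇ {n} σ g =
  allᵇ (λ i → allᵇ (λ j → size (entry g i j) ≡ᵇ rank σ i j) (finList (suc n))) (finList (suc n))
  ∧ allᵇ (λ i → allᵇ (λ j → entry g i (inject₁ j) ⊆ᵇ entry g i (Fin.suc j)) (finList n)) (finList (suc n))
  ∧ allᵇ (λ i → allᵇ (λ j → entry g (inject₁ i) j ⊆ᵇ entry g (Fin.suc i) j) (finList (suc n))) (finList n)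

-- the set of growths associated with σ (each exactly once)
growths : {n : ℕ} → Perm n → List (Grid n)
growths σ = filterᵇ (isGrowthᵇ σ) (candidates σ)

Ptab : {n : ℕ} → Grid n → Chain n
Ptab {n} g = tabulate (λ i → entry g i (fromℕ n))

Qtab : {n : ℕ} → Grid n → Chain n
Qtab {n} g = tabulate (λ j → entry g (fromℕ n) j)

chainEq : {n : ℕ} → Chain n → Chain n → Bool
chainEq T U = does (VecP.≡-dec (ListP.≡-dec ℕ._≟_) T U)

-- 𝒫(□) for the square with corners μ = Λ_{i-1,j-1}, ρ = Λ_{i-1,j}, λ = Λ_{i,j-1}, ν = Λ_{ij}
squareWeight : ℚ → ℚ → List ℕ → List ℕ → List ℕ → List ℕ → ℚ
squareWeight q t μ ρ λ′ ν = if (ρ == λ′) ∧ not (ν == λ′) then Pstep q t μ λ′ ν else 1ℚ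

weight : {n : ℕ} → ℚ → ℚ → Grid n → ℚ
weight {n} q t g =
  prodℚ (concatMap (λ i → map (λ j →
    squareWeight q t (entry g (inject₁ i) (inject₁ j)) (entry g (inject₁ i) (Fin.suc j))
                     (entry g (Fin.suc i) (inject₁ j)) (entry g (Fin.suc i) (Fin.suc j)))
    (finList n)) (finList n))

Prob : {n : ℕ} → ℚ → ℚ → Perm n → Chain n → Chain n → ℚ
Prob q t σ P Q =
  sumℚ (map (weight q t) (filterᵇ (λ g → chainEq (Ptab g) P ∧ chainEq (Qtab g) Q) (growths σ)))

-- q, t generic: nonzero and multiplicatively independent.  An identity of
-- rational functions in ℚ(q,t) is equivalent to its validity at all such points.

Generic : ℚ → ℚ → Set
Generic q t = q ≢ 0ℚ × t ≢ 0ℚ × (∀ (a b : ℤ) → zpow q a ℚ.* zpow t b ≡ 1ℚ → a ≡ ℤ.0ℤ × b ≡ ℤ.0ℤ)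

-- The rank function of the identity is min(i, j), so a growth Λ of the identity has
-- |Λ_{ij}| = min(i, j).  A containment of partitions of equal size is an equality, hence
-- every row and every column of Λ is constant beyond the diagonal: Λ_{ij} = Λ_{kk} with
-- k = min(i, j).  Thus P(Λ) = Q(Λ) and Λ is determined by its diagonal chain, while
-- conversely every standard tableau P yields such a growth Λ(P): the sum defining
-- 𝒫(id → P, Q) is empty for P ≠ Q and has the single term Λ(P) for P = Q.  In Λ(P) the
-- only squares with ρ = λ ≠ ν are the diagonal ones, where μ = ρ = λ = P⁽ⁱ⁻¹⁾ and
-- ν = P⁽ⁱ⁾; each contributes t^{n(ν/λ)} α_{ν/λ}, and the powers of t telescope to
-- t^{n(shape P)}.

module Submission where

open import Defs
open import Data.Bool using (Bool; true; false; T; _∧_)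
open import Data.Bool.Properties using (T-∧; T-≡; ∧-zeroʳ)
open import Data.Unit using (tt)
open import Data.Empty using (⊥; ⊥-elim)
open import Data.Nat as ℕ
  using (ℕ; zero; suc; _+_; _∸_; _⊓_; _≤_; _<_; _≥_; _≤ᵇ_; _<ᵇ_; _≡ᵇ_; z≤n; s≤s)
import Data.Nat.Properties as ℕₚ
open import Data.Nat.ListAction using (sum)
open import Data.Integer as ℤ using (+_)
import Data.Integer.Properties as ℤₚ
open import Data.Rational as ℚ using (ℚ; 0ℚ; 1ℚ; _*_; 1/_; ≢-nonZero)
import Data.Rational.Properties as ℚₚ
open import Data.List as List
  using (List; []; _∷_; [_]; _++_; map; concatMap; applyUpTo; upTo; filterᵇ; length)
import Data.List.Properties as Listₚ
open import Data.List.Relation.Unary.All as All using (All; []; _∷_)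
open import Data.List.Relation.Unary.Any as Any using (Any; here; there)
open import Data.List.Relation.Unary.Linked as Linked using (Linked; []; [-]; _∷_)
open import Data.List.Relation.Unary.Linked.Properties using (Linked⇒All)
open import Data.List.Relation.Unary.Unique.Propositional using (Unique)
import Data.List.Relation.Unary.Unique.Propositional.Properties as Uniqueₚ
open import Data.List.Relation.Unary.AllPairs using ([]; _∷_)
open import Data.List.Membership.Propositional using (_∈_; find)
import Data.List.Membership.Propositional.Properties as ∈ₚ
open import Data.Vec as Vec using (Vec; lookup; tabulate)
import Data.Vec.Properties as Vecₚ
open import Data.Fin as Fin using (Fin; toℕ; inject₁; fromℕ; fromℕ<)
import Data.Fin.Properties as Finₚ
open import Data.Product using (_×_; _,_; proj₁; proj₂; uncurry)
open import Data.Sum using (inj₁; inj₂)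
open import Relation.Binary.Definitions using (tri<; tri≈; tri>)
open import Algebra.Bundles using (CommutativeMonoid)
open import Algebra.Properties.CommutativeSemigroup
  (CommutativeMonoid.commutativeSemigroup ℚₚ.*-1-commutativeMonoid)
  using () renaming (interchange to *-interchange)
open import Function using (_∘_; _$_; id; Equivalence)
open import Relation.Nullary using (Dec; yes; no; does; T?)
open import Relation.Nullary.Decidable using (dec-true; dec-false)
open import Relation.Binary.PropositionalEquality hiding ([_])

does-sound : ∀ {A : Set} (a? : Dec A) → T (does a?) → A
does-sound (yes a) _ = a

T-∧⁻ : ∀ {a b} → T (a ∧ b) → T a × T b
T-∧⁻ = Equivalence.to T-∧

T-∧⁺ : ∀ {a b} → T a → T b → T (a ∧ b)
T-∧⁺ ta tb = Equivalence.from T-∧ (ta , tb)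

==-refl : ∀ κ → (κ == κ) ≡ true
==-refl κ = dec-true (Listₚ.≡-dec ℕ._≟_ κ κ) refl

==-≢ : ∀ {κ ρ} → κ ≢ ρ → (κ == ρ) ≡ false
==-≢ {κ} {ρ} = dec-false (Listₚ.≡-dec ℕ._≟_ κ ρ)

chainEq⇒≡ : ∀ {n} {P Q : Chain n} → T (chainEq P Q) → P ≡ Q
chainEq⇒≡ {P = P} {Q} = does-sound (Vecₚ.≡-dec (Listₚ.≡-dec ℕ._≟_) P Q)

chainEq-refl : ∀ {n} (P : Chain n) → T (chainEq P P)
chainEq-refl P = Equivalence.from T-≡ (dec-true (Vecₚ.≡-dec (Listₚ.≡-dec ℕ._≟_) P P) refl)

allᵇ⁺ : ∀ {A : Set} {p : A → Bool} xs → (∀ x → T (p x)) → T (allᵇ p xs)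
allᵇ⁺ []       _  = tt
allᵇ⁺ (x ∷ xs) px = T-∧⁺ (px x) (allᵇ⁺ xs px)

allᵇ-tabulate⁻ : ∀ {A : Set} {p : A → Bool} {n} (f : Fin n → A) →
                 T (allᵇ p (Vec.toList (tabulate f))) → ∀ i → T (p (f i))
allᵇ-tabulate⁻ f all Fin.zero    = proj₁ (T-∧⁻ all)
allᵇ-tabulate⁻ f all (Fin.suc i) = allᵇ-tabulate⁻ (f ∘ Fin.suc) (proj₂ (T-∧⁻ all)) i

allᵇ-finList⁻ : ∀ {n} {p : Fin n → Bool} → T (allᵇ p (finList n)) → ∀ i → T (p i)
allᵇ-finList⁻ = allᵇ-tabulate⁻ id

map-toList-tabulate : ∀ {A B : Set} {n} (f : Fin n → A) (g : A → B) (h : ℕ → B) →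
                      (∀ i → g (f i) ≡ h (toℕ i)) → map g (Vec.toList (tabulate f)) ≡ applyUpTo h n
map-toList-tabulate {n = zero}  f g h eq = refl
map-toList-tabulate {n = suc n} f g h eq =
  cong₂ _∷_ (eq Fin.zero) (map-toList-tabulate (f ∘ Fin.suc) g (h ∘ suc) (eq ∘ Fin.suc))

map-finList : ∀ {B : Set} {n} (g : Fin n → B) (h : ℕ → B) →
              (∀ i → g i ≡ h (toℕ i)) → map g (finList n) ≡ applyUpTo h n
map-finList = map-toList-tabulate id

-- Indices beyond n give the last entry.
lookupℕ : ∀ {A : Set} {n} → Vec A (suc n) → ℕ → A
lookupℕ (x Vec.∷ xs)           zero    = x
lookupℕ {n = zero}  (x Vec.∷ xs) (suc k) = x
lookupℕ {n = suc n} (x Vec.∷ xs) (suc k) = lookupℕ xs k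

lookup≡lookupℕ : ∀ {A : Set} {n} (v : Vec A (suc n)) i → lookup v i ≡ lookupℕ v (toℕ i)
lookup≡lookupℕ (x Vec.∷ xs)           Fin.zero    = refl
lookup≡lookupℕ {n = suc n} (x Vec.∷ xs) (Fin.suc i) = lookup≡lookupℕ xs i

lookupℕ-tabulate : ∀ {A : Set} {n} (f : Fin (suc n) → A) {m} (m≤n : m ≤ n) →
                   lookupℕ (tabulate f) m ≡ f (fromℕ< (s≤s m≤n))
lookupℕ-tabulate {n = n} f {m} m≤n = begin
  lookupℕ (tabulate f) m         ≡⟨ cong (lookupℕ (tabulate f)) (Finₚ.toℕ-fromℕ< (s≤s m≤n)) ⟨
  lookupℕ (tabulate f) (toℕ i)   ≡⟨ lookup≡lookupℕ (tabulate f) i ⟨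
  lookup (tabulate f) i          ≡⟨ Vecₚ.lookup∘tabulate f i ⟩
  f i                            ∎
  where open ≡-Reasoning
        i : Fin (suc n)
        i = fromℕ< (s≤s m≤n)

lookup-extensionality : ∀ {A : Set} {n} {v w : Vec A n} → (∀ i → lookup v i ≡ lookup w i) → v ≡ w
lookup-extensionality {v = v} {w} eq =
  trans (sym (Vecₚ.tabulate∘lookup v)) (trans (Vecₚ.tabulate-cong eq) (Vecₚ.tabulate∘lookup w))

prodℚ-++ : ∀ xs ys → prodℚ (xs ++ ys) ≡ prodℚ xs * prodℚ ys
prodℚ-++ []       ys = sym (ℚₚ.*-identityˡ _)
prodℚ-++ (x ∷ xs) ys = trans (cong (x *_) (prodℚ-++ xs ys)) (sym (ℚₚ.*-assoc x _ _))

prodℚ-concatMap : ∀ {A : Set} (f : A → List ℚ) xs →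
                  prodℚ (concatMap f xs) ≡ prodℚ (map (prodℚ ∘ f) xs)
prodℚ-concatMap f []       = refl
prodℚ-concatMap f (x ∷ xs) =
  trans (prodℚ-++ (f x) (concatMap f xs)) (cong (prodℚ (f x) *_) (prodℚ-concatMap f xs))

prodℚ-applyUpTo-* : ∀ n (f g : ℕ → ℚ) →
  prodℚ (applyUpTo (λ k → f k * g k) n) ≡ prodℚ (applyUpTo f n) * prodℚ (applyUpTo g n)
prodℚ-applyUpTo-* zero    f g = sym (ℚₚ.*-identityˡ 1ℚ)
prodℚ-applyUpTo-* (suc n) f g =
  trans (cong (f 0 * g 0 *_) (prodℚ-applyUpTo-* n (f ∘ suc) (g ∘ suc)))
        (*-interchange (f 0) (g 0) _ _)

prodℚ-applyUpTo-ones : ∀ n (w : ℕ → ℚ) → (∀ b → b < n → w b ≡ 1ℚ) → prodℚ (applyUpTo w n) ≡ 1ℚ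
prodℚ-applyUpTo-ones zero    w ones = refl
prodℚ-applyUpTo-ones (suc n) w ones =
  trans (cong₂ _*_ (ones 0 ℕₚ.0<1+n) (prodℚ-applyUpTo-ones n (w ∘ suc) (λ b → ones (suc b) ∘ s≤s)))
        (ℚₚ.*-identityˡ 1ℚ)

prodℚ-applyUpTo-single : ∀ n (w : ℕ → ℚ) a → a < n → (∀ b → b < n → b ≢ a → w b ≡ 1ℚ) →
                         prodℚ (applyUpTo w n) ≡ w a
prodℚ-applyUpTo-single (suc n) w zero    _ ones =
  trans (cong (w 0 *_) (prodℚ-applyUpTo-ones n (w ∘ suc) (λ b b<n → ones (suc b) (s≤s b<n) λ ())))
        (ℚₚ.*-identityʳ (w 0))
prodℚ-applyUpTo-single (suc n) w (suc a) (s≤s a<n) ones =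
  trans (cong₂ _*_ (ones 0 ℕₚ.0<1+n λ ())
                   (prodℚ-applyUpTo-single n (w ∘ suc) a a<n
                     (λ b b<n b≢a → ones (suc b) (s≤s b<n) (b≢a ∘ ℕₚ.suc-injective))))
        (ℚₚ.*-identityˡ _)

⊘-*-cancel : ∀ x y → y ≢ 0ℚ → (x ⊘ y) * y ≡ x
⊘-*-cancel x y y≢0 with y ℚₚ.≟ 0ℚ
... | yes y≡0 = ⊥-elim (y≢0 y≡0)
... | no  _   = begin
  (x * 1/ y) * y ≡⟨ ℚₚ.*-assoc x _ y ⟩
  x * (1/ y * y) ≡⟨ cong (x *_) (ℚₚ.*-inverseˡ y) ⟩
  x * 1ℚ         ≡⟨ ℚₚ.*-identityʳ x ⟩
  x              ∎
  where open ≡-Reasoning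
        instance _ = ≢-nonZero y≢0

*-≢0 : ∀ {x y} → x ≢ 0ℚ → y ≢ 0ℚ → x * y ≢ 0ℚ
*-≢0 {x} {y} x≢0 y≢0 xy≡0 = x≢0 (begin
  x              ≡⟨ ℚₚ.*-identityʳ x ⟨
  x * 1ℚ         ≡⟨ cong (x *_) (ℚₚ.*-inverseʳ y) ⟨
  x * (y * 1/ y) ≡⟨ ℚₚ.*-assoc x y _ ⟨
  (x * y) * 1/ y ≡⟨ cong (_* 1/ y) xy≡0 ⟩
  0ℚ * 1/ y      ≡⟨ ℚₚ.*-zeroˡ (1/ y) ⟩
  0ℚ             ∎)
  where open ≡-Reasoning
        instance _ = ≢-nonZero y≢0

pow-≢0 : ∀ {t} k → t ≢ 0ℚ → pow t k ≢ 0ℚ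
pow-≢0 zero    t≢0 ()
pow-≢0 (suc k) t≢0 = *-≢0 t≢0 (pow-≢0 k t≢0)

pow-+ : ∀ t a b → pow t (a + b) ≡ pow t a * pow t b
pow-+ t zero    b = sym (ℚₚ.*-identityˡ _)
pow-+ t (suc a) b = trans (cong (t *_) (pow-+ t a b)) (sym (ℚₚ.*-assoc t _ _))

zpow-difference : ∀ {t} a b → t ≢ 0ℚ → zpow t (+ a ℤ.- + b) * pow t b ≡ pow t a
zpow-difference {t} a b t≢0 with ℕₚ.≤-<-connex b a
... | inj₁ b≤a rewrite ℤₚ.m-n≡m⊖n a b | ℤₚ.⊖-≥ b≤a =
  trans (sym (pow-+ t (a ∸ b) b)) (cong (pow t) (ℕₚ.m∸n+n≡m b≤a))
... | inj₂ a<b rewrite ℤₚ.m-n≡m⊖n a b | ℤₚ.⊖-< a<b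
  with b ∸ a | ℕₚ.m∸n+n≡m (ℕₚ.<⇒≤ a<b) | ℕₚ.m>n⇒m∸n≢0 a<b
... | zero  | _        | b∸a≢0 = ⊥-elim (b∸a≢0 refl)
... | suc k | k+1+a≡b | _     = begin
  (1ℚ ⊘ tᵏ) * pow t b              ≡⟨ cong (λ c → (1ℚ ⊘ tᵏ) * pow t c) k+1+a≡b ⟨
  (1ℚ ⊘ tᵏ) * pow t (suc k + a)    ≡⟨ cong ((1ℚ ⊘ tᵏ) *_) (pow-+ t (suc k) a) ⟩
  (1ℚ ⊘ tᵏ) * (tᵏ * pow t a)       ≡⟨ ℚₚ.*-assoc (1ℚ ⊘ tᵏ) tᵏ (pow t a) ⟨
  ((1ℚ ⊘ tᵏ) * tᵏ) * pow t a       ≡⟨ cong (_* pow t a) (⊘-*-cancel 1ℚ tᵏ (pow-≢0 (suc k) t≢0)) ⟩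
  1ℚ * pow t a                     ≡⟨ ℚₚ.*-identityˡ _ ⟩
  pow t a                          ∎
  where open ≡-Reasoning
        tᵏ : ℚ
        tᵏ = pow t (suc k)

prodℚ-telescope : ∀ {t} n (e : ℕ → ℕ) → t ≢ 0ℚ →
  prodℚ (applyUpTo (λ k → zpow t (+ e (suc k) ℤ.- + e k)) n) * pow t (e 0) ≡ pow t (e n)
prodℚ-telescope zero    e t≢0 = ℚₚ.*-identityˡ _
prodℚ-telescope {t} (suc n) e t≢0 = begin
  (z 0 * rest) * pow t (e 0) ≡⟨ cong (_* pow t (e 0)) (ℚₚ.*-comm (z 0) rest) ⟩
  (rest * z 0) * pow t (e 0) ≡⟨ ℚₚ.*-assoc rest (z 0) (pow t (e 0)) ⟩
  rest * (z 0 * pow t (e 0)) ≡⟨ cong (rest *_) (zpow-difference (e 1) (e 0) t≢0) ⟩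
  rest * pow t (e 1)         ≡⟨ prodℚ-telescope n (e ∘ suc) t≢0 ⟩
  pow t (e (suc n))          ∎
  where open ≡-Reasoning
        z : ℕ → ℚ
        z k = zpow t (+ e (suc k) ℤ.- + e k)
        rest : ℚ
        rest = prodℚ (applyUpTo (z ∘ suc) n)

⊆ᵇ-refl : ∀ κ → T (κ ⊆ᵇ κ)
⊆ᵇ-refl []      = tt
⊆ᵇ-refl (k ∷ κ) = T-∧⁺ (ℕₚ.≤⇒≤ᵇ (ℕₚ.≤-refl {k})) (⊆ᵇ-refl κ)

⊆ᵇ-trans : ∀ κ ρ ν → T (κ ⊆ᵇ ρ) → T (ρ ⊆ᵇ ν) → T (κ ⊆ᵇ ν)
⊆ᵇ-trans []      _       _       _    _    = tt
⊆ᵇ-trans (k ∷ κ) (r ∷ ρ) (v ∷ ν) κ⊆ρ ρ⊆ν =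
  let k≤r , κ⊆ρ′ = T-∧⁻ κ⊆ρ ; r≤v , ρ⊆ν′ = T-∧⁻ ρ⊆ν in
  T-∧⁺ (ℕₚ.≤⇒≤ᵇ (ℕₚ.≤-trans (ℕₚ.≤ᵇ⇒≤ k r k≤r) (ℕₚ.≤ᵇ⇒≤ r v r≤v))) (⊆ᵇ-trans κ ρ ν κ⊆ρ′ ρ⊆ν′)

⊆ᵇ⇒size≤ : ∀ κ ρ → T (κ ⊆ᵇ ρ) → size κ ≤ size ρ
⊆ᵇ⇒size≤ []      _       _   = z≤n
⊆ᵇ⇒size≤ (k ∷ κ) (r ∷ ρ) κ⊆ρ =
  let k≤r , κ⊆ρ′ = T-∧⁻ κ⊆ρ in ℕₚ.+-mono-≤ (ℕₚ.≤ᵇ⇒≤ k r k≤r) (⊆ᵇ⇒size≤ κ ρ κ⊆ρ′)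

-- Without positivity, ρ could be κ followed by zero parts.
⊆ᵇ∧size≡⇒≡ : ∀ κ ρ → T (κ ⊆ᵇ ρ) → All (0 <_) ρ → size κ ≡ size ρ → κ ≡ ρ
⊆ᵇ∧size≡⇒≡ []      []      _   _        _  = refl
⊆ᵇ∧size≡⇒≡ []      (r ∷ ρ) _   (0<r ∷ _) eq =
  ⊥-elim (ℕₚ.<⇒≢ (ℕₚ.<-≤-trans 0<r (ℕₚ.m≤m+n r (sum ρ))) eq)
⊆ᵇ∧size≡⇒≡ (k ∷ κ) (r ∷ ρ) κ⊆ρ (_ ∷ ρ>0) eq =
  cong₂ _∷_ k≡r (⊆ᵇ∧size≡⇒≡ κ ρ κ⊆ρ′ ρ>0 (ℕₚ.+-cancelˡ-≡ k _ _ (trans eq (cong (_+ sum ρ) (sym k≡r)))))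
  where
  k≤r : k ≤ r
  k≤r = ℕₚ.≤ᵇ⇒≤ k r (proj₁ (T-∧⁻ κ⊆ρ))
  κ⊆ρ′ : T (κ ⊆ᵇ ρ)
  κ⊆ρ′ = proj₂ (T-∧⁻ {k ≤ᵇ r} κ⊆ρ)
  k≡r : k ≡ r
  k≡r = ℕₚ.≤-antisym k≤r (ℕₚ.+-cancelʳ-≤ (sum ρ) r k
          (ℕₚ.≤-trans (ℕₚ.≤-reflexive (sym eq)) (ℕₚ.+-monoʳ-≤ k (⊆ᵇ⇒size≤ κ ρ κ⊆ρ′))))

row-zero : ∀ κ → row κ 0 ≡ 0
row-zero []      = refl
row-zero (_ ∷ _) = refl

⊆ᴾ⇒⊆ᵇ : ∀ κ ρ → All (0 <_) κ → κ ⊆ᴾ ρ → T (κ ⊆ᵇ ρ)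
⊆ᴾ⇒⊆ᵇ []      _       _          _   = tt
⊆ᴾ⇒⊆ᵇ (k ∷ κ) []      (0<k ∷ _)  κ⊆ρ = ⊥-elim (ℕₚ.<⇒≱ 0<k (κ⊆ρ 1))
⊆ᴾ⇒⊆ᵇ (k ∷ κ) (r ∷ ρ) (_ ∷ κ>0) κ⊆ρ = T-∧⁺ (ℕₚ.≤⇒≤ᵇ (κ⊆ρ 1)) (⊆ᴾ⇒⊆ᵇ κ ρ κ>0 tail⊆)
  where
  tail⊆ : κ ⊆ᴾ ρ
  tail⊆ zero    = subst (_≤ row ρ 0) (sym (row-zero κ)) z≤n
  tail⊆ (suc y) = κ⊆ρ (suc (suc y))

parts≤sum : ∀ x → All (_≤ sum x) x
parts≤sum []       = []
parts≤sum (r ∷ rs) = ℕₚ.m≤m+n r (sum rs) ∷ All.map (λ r′≤ → ℕₚ.≤-trans r′≤ (ℕₚ.m≤n+m (sum rs) r)) (parts≤sum rs)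

parts≤head : ∀ {r x} → Linked _≥_ (r ∷ x) → All (_≤ r) x
parts≤head [-]          = []
parts≤head (r≥r′ ∷ lnk) = Linked⇒All (λ a≥b b≥c → ℕₚ.≤-trans b≥c a≥b) r≥r′ lnk

partsF-positive : ∀ f m b {x} → x ∈ partsF f m b → All (0 <_) x
partsF-positive zero    zero    b (here refl) = []
partsF-positive (suc f) zero    b (here refl) = []
partsF-positive (suc f) (suc m) b {x} x∈ = positive (∈ₚ.∈-concatMap⁻ _ {xs = upTo (b ⊓ suc m)} x∈)
  where
  positive : ∀ {ks} → Any (λ k → x ∈ map (suc k ∷_) (partsF f (suc m ∸ suc k) (suc k))) ks → All (0 <_) x
  positive (here x∈k) with _ , x′∈ , refl ← ∈ₚ.∈-map⁻ _ x∈k = s≤s z≤n ∷ partsF-positive f _ _ x′∈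
  positive (there x∈ks) = positive x∈ks

∈-partsF : ∀ f m b x → IsPartition x → All (_≤ b) x → sum x ≡ m → m ≤ f → x ∈ partsF f m b
∈-partsF zero    _       _ []      _ _ refl _ = here refl
∈-partsF (suc f) _       _ []      _ _ refl _ = here refl
∈-partsF zero    m       b (r ∷ x) (0<r ∷ _ , _) _ refl m≤0 =
  ⊥-elim (ℕₚ.<⇒≱ (ℕₚ.<-≤-trans 0<r (ℕₚ.m≤m+n r (sum x))) m≤0)
∈-partsF (suc f) (suc m) b (suc k ∷ x) (_ ∷ x>0 , lnk) (k<b ∷ _) eq (s≤s m≤f) =
  ∈ₚ.∈-concatMap⁺ _ (Any.map (λ { refl → ∈ₚ.∈-map⁺ (suc k ∷_) x∈ }) (∈ₚ.∈-upTo⁺ k<b⊓m))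
  where
  k+x≡m : k + sum x ≡ m
  k+x≡m = ℕₚ.suc-injective eq
  k<b⊓m : k < b ⊓ suc m
  k<b⊓m = ℕₚ.⊓-glb k<b (s≤s (ℕₚ.m+n≤o⇒m≤o k (ℕₚ.≤-reflexive k+x≡m)))
  x∈ : x ∈ partsF f (m ∸ k) (suc k)
  x∈ = ∈-partsF f (m ∸ k) (suc k) x (x>0 , Linked.tail lnk) (parts≤head lnk)
         (sym (trans (cong (_∸ k) (sym k+x≡m)) (ℕₚ.m+n∸m≡n k (sum x))))
         (ℕₚ.≤-trans (ℕₚ.m∸n≤m m k) m≤f)

-- As h recovers a from the elements of f a, distinct elements of xs have disjoint images.
concatMap-unique : ∀ {A B : Set} (f : A → List B) (h : B → A) → (∀ {a b} → b ∈ f a → h b ≡ a) →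
                   (∀ a → Unique (f a)) → ∀ {xs} → Unique xs → Unique (concatMap f xs)
concatMap-unique f h h∘f≡id f-unique {[]}     []               = []
concatMap-unique f h h∘f≡id f-unique {x ∷ xs} (x∉xs ∷ xs-unique) =
  Uniqueₚ.++⁺ (f-unique x) (concatMap-unique f h h∘f≡id f-unique xs-unique) disjoint
  where
  disjoint : ∀ {v} → v ∈ f x × v ∈ concatMap f xs → ⊥
  disjoint (v∈fx , v∈fxs) = uncurry _$_ $
    All.lookupAny x∉xs (Any.map (λ v∈fy → trans (sym (h∘f≡id v∈fx)) (h∘f≡id v∈fy))
                               (∈ₚ.∈-concatMap⁻ f {xs = xs} v∈fxs))

partsF-unique : ∀ f m b → Unique (partsF f m b)
partsF-unique zero    zero    b = [] ∷ []
partsF-unique zero    (suc m) b = []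
partsF-unique (suc f) zero    b = [] ∷ []
partsF-unique (suc f) (suc m) b =
  concatMap-unique _ (ℕ.pred ∘ headOr0) head≡
    (λ k → Uniqueₚ.map⁺ Listₚ.∷-injectiveʳ (partsF-unique f (suc m ∸ suc k) (suc k)))
    (Uniqueₚ.upTo⁺ (b ⊓ suc m))
  where
  headOr0 : List ℕ → ℕ
  headOr0 []      = 0
  headOr0 (r ∷ _) = r
  head≡ : ∀ {k x xs} → x ∈ map (suc k ∷_) xs → ℕ.pred (headOr0 x) ≡ k
  head≡ x∈ with _ , _ , refl ← ∈ₚ.∈-map⁻ _ x∈ = refl

∈-partitions : ∀ x → IsPartition x → x ∈ partitions (size x)
∈-partitions x x-part = ∈-partsF (size x) (size x) (size x) x x-part (parts≤sum x) refl ℕₚ.≤-refl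

partitions-positive : ∀ {m x} → x ∈ partitions m → All (0 <_) x
partitions-positive {m} = partsF-positive m m m

partitions-unique : ∀ m → Unique (partitions m)
partitions-unique m = partsF-unique m m m

choices-unique : ∀ {A : Set} {m} (xss : Vec (List A) m) → (∀ i → Unique (lookup xss i)) →
                 Unique (choices xss)
choices-unique Vec.[]         _      = [] ∷ []
choices-unique (xs Vec.∷ xss) unique =
  concatMap-unique _ Vec.head head≡
    (λ x → Uniqueₚ.map⁺ Vecₚ.∷-injectiveʳ (choices-unique xss (unique ∘ Fin.suc)))
    (unique Fin.zero)
  where
  head≡ : ∀ {A : Set} {m} {x : A} {v : Vec A (suc m)} {vs} → v ∈ map (x Vec.∷_) vs → Vec.head v ≡ x
  head≡ v∈ with _ , _ , refl ← ∈ₚ.∈-map⁻ _ v∈ = refl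

∈-choices⁻ : ∀ {A : Set} {m} (xss : Vec (List A) m) {v} → v ∈ choices xss → ∀ i → lookup v i ∈ lookup xss i
∈-choices⁻ (xs Vec.∷ xss) v∈ i with find (∈ₚ.∈-concatMap⁻ _ {xs = xs} v∈)
... | x , x∈xs , v∈x∷ with ∈ₚ.∈-map⁻ _ v∈x∷
... | v′ , v′∈ , refl with i
... | Fin.zero  = x∈xs
... | Fin.suc j = ∈-choices⁻ xss v′∈ j

∈-choices⁺ : ∀ {A : Set} {m} (xss : Vec (List A) m) (v : Vec A m) →
             (∀ i → lookup v i ∈ lookup xss i) → v ∈ choices xss
∈-choices⁺ Vec.[]         Vec.[]       _  = here refl
∈-choices⁺ (xs Vec.∷ xss) (x Vec.∷ v) v∈ =
  ∈ₚ.∈-concatMap⁺ _ (Any.map (λ { refl → ∈ₚ.∈-map⁺ (x Vec.∷_) (∈-choices⁺ xss v (v∈ ∘ Fin.suc)) })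
                             (v∈ Fin.zero))

module _ {n : ℕ} (σ : Perm n) where
  private
    cellChoices : Fin (suc n) → Fin (suc n) → List (List ℕ)
    cellChoices i j = partitions (rank σ i j)

    rowChoices : Fin (suc n) → List (Vec (List ℕ) (suc n))
    rowChoices i = choices (tabulate (cellChoices i))

  ∈-candidates⁺ : (g : Grid n) → (∀ i j → entry g i j ∈ partitions (rank σ i j)) → g ∈ candidates σ
  ∈-candidates⁺ g entries∈ = ∈-choices⁺ (tabulate rowChoices) g λ i →
    subst (lookup g i ∈_) (sym (Vecₚ.lookup∘tabulate rowChoices i))
      (∈-choices⁺ (tabulate (cellChoices i)) (lookup g i) λ j →
        subst (entry g i j ∈_) (sym (Vecₚ.lookup∘tabulate (cellChoices i) j)) (entries∈ i j))

  ∈-candidates⁻ : ∀ {g : Grid n} → g ∈ candidates σ → ∀ i j → entry g i j ∈ partitions (rank σ i j)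
  ∈-candidates⁻ {g} g∈ i j =
    subst (entry g i j ∈_) (Vecₚ.lookup∘tabulate (cellChoices i) j)
      (∈-choices⁻ (tabulate (cellChoices i))
        (subst (lookup g i ∈_) (Vecₚ.lookup∘tabulate rowChoices i) (∈-choices⁻ (tabulate rowChoices) g∈ i)) j)

  candidates-unique : Unique (candidates σ)
  candidates-unique = choices-unique (tabulate rowChoices) λ i →
    subst Unique (sym (Vecₚ.lookup∘tabulate rowChoices i)) (choices-unique (tabulate (cellChoices i)) λ j →
      subst Unique (sym (Vecₚ.lookup∘tabulate (cellChoices i) j)) (partitions-unique (rank σ i j)))

growths-unique : ∀ {n} (σ : Perm n) → Unique (growths σ)
growths-unique σ = Uniqueₚ.filter⁺ (T? ∘ isGrowthᵇ σ) (candidates-unique σ)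

length-filterᵇ-map : ∀ {A B : Set} (p : B → Bool) (p′ : A → Bool) (g : A → B) →
                     (∀ x → p′ x ≡ p (g x)) → ∀ xs →
                     length (filterᵇ p′ xs) ≡ length (filterᵇ p (map g xs))
length-filterᵇ-map p p′ g p′≡p∘g []       = refl
length-filterᵇ-map p p′ g p′≡p∘g (x ∷ xs) rewrite p′≡p∘g x with p (g x)
... | true  = cong suc (length-filterᵇ-map p p′ g p′≡p∘g xs)
... | false = length-filterᵇ-map p p′ g p′≡p∘g xs

count-<ᵇ : ∀ n c → length (filterᵇ (_<ᵇ c) (upTo n)) ≡ n ⊓ c
count-<ᵇ zero    c       = refl
count-<ᵇ (suc n) zero    =
  cong length (Listₚ.filter-none (λ k → T? (k <ᵇ 0)) (All.universal (λ _ → id) (upTo (suc n))))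
count-<ᵇ (suc n) (suc c) = cong suc (begin
  length (filterᵇ (_<ᵇ suc c) (applyUpTo suc n))     ≡⟨ cong (length ∘ filterᵇ (_<ᵇ suc c)) (Listₚ.map-upTo suc n) ⟨
  length (filterᵇ (_<ᵇ suc c) (map suc (upTo n)))    ≡⟨ length-filterᵇ-map _ _ suc (λ _ → refl) (upTo n) ⟨
  length (filterᵇ (_<ᵇ c) (upTo n))                  ≡⟨ count-<ᵇ n c ⟩
  n ⊓ c                                              ∎)
  where open ≡-Reasoning

<ᵇ-⊓ : ∀ k a b → ((k <ᵇ a) ∧ (k <ᵇ b)) ≡ (k <ᵇ (a ⊓ b))
<ᵇ-⊓ zero    zero    b       = refl
<ᵇ-⊓ zero    (suc a) zero    = refl
<ᵇ-⊓ zero    (suc a) (suc b) = refl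
<ᵇ-⊓ (suc k) zero    b       = refl
<ᵇ-⊓ (suc k) (suc a) zero    = ∧-zeroʳ (k <ᵇ a)
<ᵇ-⊓ (suc k) (suc a) (suc b) = <ᵇ-⊓ k a b

rank-idPerm : ∀ n (i j : Fin (suc n)) → rank (idPerm n) i j ≡ toℕ i ⊓ toℕ j
rank-idPerm n i j = begin
  rank (idPerm n) i j                     ≡⟨ length-filterᵇ-map (_<ᵇ c) _ toℕ (λ k → <ᵇ-⊓ (toℕ k) (toℕ j) (toℕ i))
                                                                (finList n) ⟩
  length (filterᵇ (_<ᵇ c) (map toℕ (finList n)))
                                          ≡⟨ cong (length ∘ filterᵇ (_<ᵇ c)) (map-finList {n = n} toℕ id (λ _ → refl)) ⟩
  length (filterᵇ (_<ᵇ c) (upTo n))       ≡⟨ count-<ᵇ n c ⟩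
  n ⊓ c                                   ≡⟨ ℕₚ.m≥n⇒m⊓n≡n (ℕₚ.≤-trans (ℕₚ.m⊓n≤m _ _) (Finₚ.toℕ≤pred[n] j)) ⟩
  toℕ j ⊓ toℕ i                           ≡⟨ ℕₚ.⊓-comm (toℕ j) (toℕ i) ⟩
  toℕ i ⊓ toℕ j                           ∎
  where open ≡-Reasoning
        c : ℕ
        c = toℕ j ⊓ toℕ i

record IsGrowth {n : ℕ} (σ : Perm n) (g : Grid n) : Set where
  field
    size-entry : ∀ i j → size (entry g i j) ≡ rank σ i j
    ⊆-suc-j    : ∀ i j → T (entry g i (inject₁ j) ⊆ᵇ entry g i (Fin.suc j))
    ⊆-suc-i    : ∀ i j → T (entry g (inject₁ i) j ⊆ᵇ entry g (Fin.suc i) j)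

module _ {n : ℕ} (σ : Perm n) {g : Grid n} where
  private
    sizeOK : Fin (suc n) → Fin (suc n) → Bool
    sizeOK i j = size (entry g i j) ≡ᵇ rank σ i j

    rightOK : Fin (suc n) → Fin n → Bool
    rightOK i j = entry g i (inject₁ j) ⊆ᵇ entry g i (Fin.suc j)

    upOK : Fin n → Fin (suc n) → Bool
    upOK i j = entry g (inject₁ i) j ⊆ᵇ entry g (Fin.suc i) j

    allᵇ² : ∀ {k l} → (Fin k → Fin l → Bool) → Bool
    allᵇ² {k} {l} p = allᵇ (λ i → allᵇ (p i) (finList l)) (finList k)

    allᵇ²⁻ : ∀ {k l} (p : Fin k → Fin l → Bool) → T (allᵇ² p) → ∀ i j → T (p i j)
    allᵇ²⁻ {l = l} p all i = allᵇ-finList⁻ {p = p i} (allᵇ-finList⁻ {p = λ i → allᵇ (p i) (finList l)} all i)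

    allᵇ²⁺ : ∀ {k l} (p : Fin k → Fin l → Bool) → (∀ i j → T (p i j)) → T (allᵇ² p)
    allᵇ²⁺ {k} {l} p all = allᵇ⁺ (finList k) λ i → allᵇ⁺ (finList l) (all i)

  isGrowthᵇ⇒IsGrowth : T (isGrowthᵇ σ g) → IsGrowth σ g
  isGrowthᵇ⇒IsGrowth growth = record
    { size-entry = λ i j → ℕₚ.≡ᵇ⇒≡ _ _ (allᵇ²⁻ sizeOK sizes i j)
    ; ⊆-suc-j    = allᵇ²⁻ rightOK right
    ; ⊆-suc-i    = allᵇ²⁻ upOK up
    }
    where
    sizes : T (allᵇ² sizeOK)
    sizes = proj₁ (T-∧⁻ growth)
    right : T (allᵇ² rightOK)
    right = proj₁ (T-∧⁻ (proj₂ (T-∧⁻ {allᵇ² sizeOK} growth)))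
    up : T (allᵇ² upOK)
    up = proj₂ (T-∧⁻ {allᵇ² rightOK} (proj₂ (T-∧⁻ {allᵇ² sizeOK} growth)))

  IsGrowth⇒isGrowthᵇ : IsGrowth σ g → T (isGrowthᵇ σ g)
  IsGrowth⇒isGrowthᵇ growth =
    T-∧⁺ (allᵇ²⁺ sizeOK λ i j → ℕₚ.≡⇒≡ᵇ _ _ (size-entry i j))
         (T-∧⁺ (allᵇ²⁺ rightOK ⊆-suc-j) (allᵇ²⁺ upOK ⊆-suc-i))
    where open IsGrowth growth

∈-growths⁺ : ∀ {n} (σ : Perm n) {g} → (∀ i j → entry g i j ∈ partitions (rank σ i j)) →
             IsGrowth σ g → g ∈ growths σ
∈-growths⁺ σ {g} entries∈ growth =
  ∈ₚ.∈-filter⁺ (T? ∘ isGrowthᵇ σ) (∈-candidates⁺ σ g entries∈) (IsGrowth⇒isGrowthᵇ σ growth)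

∈-growths⁻ : ∀ {n} (σ : Perm n) {g} → g ∈ growths σ →
             (∀ i j → entry g i j ∈ partitions (rank σ i j)) × IsGrowth σ g
∈-growths⁻ σ g∈ =
  let g∈candidates , growth = ∈ₚ.∈-filter⁻ (T? ∘ isGrowthᵇ σ) {xs = candidates σ} g∈ in
  ∈-candidates⁻ σ g∈candidates , isGrowthᵇ⇒IsGrowth σ growth

module _ {n : ℕ} {P : Chain n} (syt : IsSYT P) where
  private
    p : ℕ → List ℕ
    p = lookupℕ P

  syt-zero : p 0 ≡ []
  syt-zero = trans (sym (lookup≡lookupℕ P Fin.zero)) (proj₁ syt)

  syt-step : ∀ {k} → k < n → p k ⋖ p (suc k)
  syt-step {k} k<n = subst₂ _⋖_
    (trans (lookup≡lookupℕ P (inject₁ i)) (cong p (trans (Finₚ.toℕ-inject₁ i) (Finₚ.toℕ-fromℕ< k<n))))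
    (trans (lookup≡lookupℕ P (Fin.suc i)) (cong (p ∘ suc) (Finₚ.toℕ-fromℕ< k<n)))
    (proj₂ syt i)
    where i : Fin n
          i = fromℕ< k<n

  syt-partition : ∀ {k} → k ≤ n → IsPartition (p k)
  syt-partition {zero}  _   rewrite syt-zero = [] , []
  syt-partition {suc k} k<n = proj₁ (proj₂ (syt-step k<n))

  syt-size : ∀ {k} → k ≤ n → size (p k) ≡ k
  syt-size {zero}  _   rewrite syt-zero = refl
  syt-size {suc k} k<n = trans (proj₂ (proj₂ (proj₂ (syt-step k<n)))) (cong suc (syt-size (ℕₚ.<⇒≤ k<n)))

  syt-suc-≢ : ∀ {k} → k < n → p (suc k) ≢ p k
  syt-suc-≢ {k} k<n eq = ℕₚ.1+n≢n (begin
    suc k            ≡⟨ syt-size k<n ⟨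
    size (p (suc k)) ≡⟨ cong size eq ⟩
    size (p k)       ≡⟨ syt-size (ℕₚ.<⇒≤ k<n) ⟩
    k                ∎)
    where open ≡-Reasoning

  syt-⊆ : ∀ {k} l → k ≤ l → l ≤ n → T (p k ⊆ᵇ p l)
  syt-⊆ {k} l k≤l l≤n with ℕₚ.m≤n⇒m<n∨m≡n k≤l
  ... | inj₂ refl = ⊆ᵇ-refl (p k)
  syt-⊆ {k} (suc l) _ l<n | inj₁ (s≤s k≤l) =
    ⊆ᵇ-trans (p k) (p l) (p (suc l)) (syt-⊆ l k≤l (ℕₚ.<⇒≤ l<n))
      (⊆ᴾ⇒⊆ᵇ (p l) (p (suc l)) (proj₁ (syt-partition (ℕₚ.<⇒≤ l<n))) (proj₁ (proj₂ (proj₂ (syt-step l<n)))))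

  syt-∈-partitions : ∀ {k} → k ≤ n → p k ∈ partitions k
  syt-∈-partitions k≤n = subst (λ m → p _ ∈ partitions m) (syt-size k≤n) (∈-partitions _ (syt-partition k≤n))

-- Growths of the identity permutation

-- Λ a b stands for Λ_{ab}, 0 ≤ a, b ≤ n, of a growth of the identity.
record IsIdentityGrowth (n : ℕ) (Λ : ℕ → ℕ → List ℕ) : Set where
  field
    positive : ∀ {a b} → a ≤ n → b ≤ n → All (0 <_) (Λ a b)
    size≡⊓   : ∀ {a b} → a ≤ n → b ≤ n → size (Λ a b) ≡ a ⊓ b
    ⊆-suc-b  : ∀ {a b} → a ≤ n → b < n → T (Λ a b ⊆ᵇ Λ a (suc b))
    ⊆-suc-a  : ∀ {a b} → a < n → b ≤ n → T (Λ a b ⊆ᵇ Λ (suc a) b)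

⊆ᵇ-chain-constant : ∀ (f : ℕ → List ℕ) {m N c} →
  (∀ {k} → m ≤ k → k < N → T (f k ⊆ᵇ f (suc k))) →
  (∀ {k} → m ≤ k → k ≤ N → All (0 <_) (f k) × size (f k) ≡ c) →
  ∀ k → m ≤ k → k ≤ N → f k ≡ f m
⊆ᵇ-chain-constant f step ok k m≤k k≤N with ℕₚ.m≤n⇒m<n∨m≡n m≤k
... | inj₂ refl = refl
⊆ᵇ-chain-constant f {c = c} step ok (suc k) _ k<N | inj₁ (s≤s m≤k) =
  trans (sym (⊆ᵇ∧size≡⇒≡ (f k) (f (suc k)) (step m≤k k<N) (proj₁ ok-suc-k)
                          (trans (proj₂ ok-k) (sym (proj₂ ok-suc-k)))))
        (⊆ᵇ-chain-constant f step ok k m≤k (ℕₚ.<⇒≤ k<N))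
  where
  ok-k : All (0 <_) (f k) × size (f k) ≡ c
  ok-k = ok m≤k (ℕₚ.<⇒≤ k<N)
  ok-suc-k : All (0 <_) (f (suc k)) × size (f (suc k)) ≡ c
  ok-suc-k = ok (ℕₚ.m≤n⇒m≤1+n m≤k) k<N

identityGrowth-diagonal : ∀ {n Λ} → IsIdentityGrowth n Λ →
                          ∀ {a b} → a ≤ n → b ≤ n → Λ a b ≡ Λ (a ⊓ b) (a ⊓ b)
identityGrowth-diagonal {Λ = Λ} growth {a} {b} a≤n b≤n with ℕₚ.≤-total a b
... | inj₁ a≤b rewrite ℕₚ.m≤n⇒m⊓n≡m a≤b =
  ⊆ᵇ-chain-constant (Λ a) (λ _ → ⊆-suc-b a≤n)
    (λ a≤k k≤n → positive a≤n k≤n , trans (size≡⊓ a≤n k≤n) (ℕₚ.m≤n⇒m⊓n≡m a≤k)) b a≤b b≤n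
  where open IsIdentityGrowth growth
... | inj₂ b≤a rewrite ℕₚ.m≥n⇒m⊓n≡n b≤a =
  ⊆ᵇ-chain-constant (λ k → Λ k b) (λ _ k<n → ⊆-suc-a k<n b≤n)
    (λ b≤k k≤n → positive k≤n b≤n , trans (size≡⊓ k≤n b≤n) (ℕₚ.m≥n⇒m⊓n≡n b≤k)) a b≤a a≤n
  where open IsIdentityGrowth growth

gridℕ : ∀ {n} → Grid n → ℕ → ℕ → List ℕ
gridℕ g a b = lookupℕ (lookupℕ g a) b

entry≡gridℕ : ∀ {n} (g : Grid n) {i j a b} → toℕ i ≡ a → toℕ j ≡ b → entry g i j ≡ gridℕ g a b
entry≡gridℕ g {i} {j} refl refl =
  trans (cong (λ r → lookup r j) (lookup≡lookupℕ g i)) (lookup≡lookupℕ (lookupℕ g (toℕ i)) j)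

growth⇒IsIdentityGrowth : ∀ {n} {g : Grid n} → g ∈ growths (idPerm n) → IsIdentityGrowth n (gridℕ g)
growth⇒IsIdentityGrowth {n} {g} g∈ = record
  { positive = λ a≤n b≤n →
      subst (All (0 <_)) (entry≡gridℕ g (toℕ-fin a≤n) (toℕ-fin b≤n))
        (partitions-positive {rank (idPerm n) (fin a≤n) (fin b≤n)}
          (proj₁ (∈-growths⁻ (idPerm n) g∈) (fin a≤n) (fin b≤n)))
  ; size≡⊓ = λ {a} {b} a≤n b≤n → begin
      size (gridℕ g a b)                        ≡⟨ cong size (entry≡gridℕ g (toℕ-fin a≤n) (toℕ-fin b≤n)) ⟨
      size (entry g (fin a≤n) (fin b≤n))        ≡⟨ size-entry (fin a≤n) (fin b≤n) ⟩
      rank (idPerm n) (fin a≤n) (fin b≤n)       ≡⟨ rank-idPerm n (fin a≤n) (fin b≤n) ⟩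
      toℕ (fin a≤n) ⊓ toℕ (fin b≤n)             ≡⟨ cong₂ _⊓_ (toℕ-fin a≤n) (toℕ-fin b≤n) ⟩
      a ⊓ b                                     ∎
  ; ⊆-suc-b = λ a≤n b<n → subst₂ (λ κ ρ → T (κ ⊆ᵇ ρ))
      (entry≡gridℕ g (toℕ-fin a≤n) (trans (Finₚ.toℕ-inject₁ _) (Finₚ.toℕ-fromℕ< b<n)))
      (entry≡gridℕ g (toℕ-fin a≤n) (cong suc (Finₚ.toℕ-fromℕ< b<n)))
      (⊆-suc-j (fin a≤n) (fromℕ< b<n))
  ; ⊆-suc-a = λ a<n b≤n → subst₂ (λ κ ρ → T (κ ⊆ᵇ ρ))
      (entry≡gridℕ g (trans (Finₚ.toℕ-inject₁ _) (Finₚ.toℕ-fromℕ< a<n)) (toℕ-fin b≤n))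
      (entry≡gridℕ g (cong suc (Finₚ.toℕ-fromℕ< a<n)) (toℕ-fin b≤n))
      (⊆-suc-i (fromℕ< a<n) (fin b≤n))
  }
  where
  open IsGrowth (proj₂ (∈-growths⁻ (idPerm n) g∈))
  open ≡-Reasoning
  fin : ∀ {a} → a ≤ n → Fin (suc n)
  fin a≤n = fromℕ< (s≤s a≤n)
  toℕ-fin : ∀ {a} (a≤n : a ≤ n) → toℕ (fin a≤n) ≡ a
  toℕ-fin a≤n = Finₚ.toℕ-fromℕ< (s≤s a≤n)

gridOf : ∀ {n} → Chain n → Grid n
gridOf P = tabulate (λ i → tabulate (λ j → lookupℕ P (toℕ i ⊓ toℕ j)))

entry-gridOf : ∀ {n} (P : Chain n) i j → entry (gridOf P) i j ≡ lookupℕ P (toℕ i ⊓ toℕ j)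
entry-gridOf {n} P i j =
  trans (cong (λ r → lookup r j) (Vecₚ.lookup∘tabulate (λ i → tabulate (cell i)) i))
        (Vecₚ.lookup∘tabulate (cell i) j)
  where cell : Fin (suc n) → Fin (suc n) → List ℕ
        cell i j = lookupℕ P (toℕ i ⊓ toℕ j)

Ptab-gridOf : ∀ {n} (P : Chain n) → Ptab (gridOf P) ≡ P
Ptab-gridOf {n} P = lookup-extensionality λ i → begin
  lookup (Ptab (gridOf P)) i          ≡⟨ Vecₚ.lookup∘tabulate (λ i → entry (gridOf P) i (fromℕ n)) i ⟩
  entry (gridOf P) i (fromℕ n)        ≡⟨ entry-gridOf P i (fromℕ n) ⟩
  lookupℕ P (toℕ i ⊓ toℕ (fromℕ n))   ≡⟨ cong (λ m → lookupℕ P (toℕ i ⊓ m)) (Finₚ.toℕ-fromℕ n) ⟩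
  lookupℕ P (toℕ i ⊓ n)               ≡⟨ cong (lookupℕ P) (ℕₚ.m≤n⇒m⊓n≡m (Finₚ.toℕ≤pred[n] i)) ⟩
  lookupℕ P (toℕ i)                   ≡⟨ lookup≡lookupℕ P i ⟨
  lookup P i                          ∎
  where open ≡-Reasoning

Qtab-gridOf : ∀ {n} (P : Chain n) → Qtab (gridOf P) ≡ P
Qtab-gridOf {n} P = lookup-extensionality λ i → begin
  lookup (Qtab (gridOf P)) i          ≡⟨ Vecₚ.lookup∘tabulate (entry (gridOf P) (fromℕ n)) i ⟩
  entry (gridOf P) (fromℕ n) i        ≡⟨ entry-gridOf P (fromℕ n) i ⟩
  lookupℕ P (toℕ (fromℕ n) ⊓ toℕ i)   ≡⟨ cong (λ m → lookupℕ P (m ⊓ toℕ i)) (Finₚ.toℕ-fromℕ n) ⟩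
  lookupℕ P (n ⊓ toℕ i)               ≡⟨ cong (lookupℕ P) (ℕₚ.m≥n⇒m⊓n≡n (Finₚ.toℕ≤pred[n] i)) ⟩
  lookupℕ P (toℕ i)                   ≡⟨ lookup≡lookupℕ P i ⟨
  lookup P i                          ∎
  where open ≡-Reasoning

gridOf-∈-growths : ∀ {n} {P : Chain n} → IsSYT P → gridOf P ∈ growths (idPerm n)
gridOf-∈-growths {n} {P} syt = ∈-growths⁺ (idPerm n) entries∈ (record
  { size-entry = λ i j → trans (cong size (entry-gridOf P i j))
                               (trans (syt-size {P = P} syt (⊓≤n i j)) (sym (rank-idPerm n i j)))
  ; ⊆-suc-j    = λ i j → gridOf-⊆ {i} {i} ℕₚ.≤-refl (inject₁≤suc j)
  ; ⊆-suc-i    = λ i j → gridOf-⊆ {j = j} {j} (inject₁≤suc i) ℕₚ.≤-refl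
  })
  where
  ⊓≤n : ∀ (i j : Fin (suc n)) → toℕ i ⊓ toℕ j ≤ n
  ⊓≤n i j = ℕₚ.≤-trans (ℕₚ.m⊓n≤m (toℕ i) (toℕ j)) (Finₚ.toℕ≤pred[n] i)

  entries∈ : ∀ i j → entry (gridOf P) i j ∈ partitions (rank (idPerm n) i j)
  entries∈ i j = subst₂ _∈_ (sym (entry-gridOf P i j)) (cong partitions (sym (rank-idPerm n i j)))
                   (syt-∈-partitions {P = P} syt (⊓≤n i j))

  gridOf-⊆ : ∀ {i i′ j j′} → toℕ i ≤ toℕ i′ → toℕ j ≤ toℕ j′ →
             T (entry (gridOf P) i j ⊆ᵇ entry (gridOf P) i′ j′)
  gridOf-⊆ {i} {i′} {j} {j′} i≤i′ j≤j′ =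
    subst₂ (λ κ ρ → T (κ ⊆ᵇ ρ)) (sym (entry-gridOf P i j)) (sym (entry-gridOf P i′ j′))
      (syt-⊆ {P = P} syt _ (ℕₚ.⊓-mono-≤ i≤i′ j≤j′) (⊓≤n i′ j′))

  inject₁≤suc : ∀ (k : Fin n) → toℕ (inject₁ k) ≤ toℕ (Fin.suc k)
  inject₁≤suc k = ℕₚ.≤-trans (ℕₚ.≤-reflexive (Finₚ.toℕ-inject₁ k)) (ℕₚ.n≤1+n (toℕ k))

module _ {n : ℕ} {g : Grid n} (g∈ : g ∈ growths (idPerm n)) where
  private
    diagonal : ∀ {a b} → a ≤ n → b ≤ n → gridℕ g a b ≡ gridℕ g (a ⊓ b) (a ⊓ b)
    diagonal = identityGrowth-diagonal (growth⇒IsIdentityGrowth g∈)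

    lookupℕ-Ptab : ∀ {m} → m ≤ n → lookupℕ (Ptab g) m ≡ gridℕ g m m
    lookupℕ-Ptab {m} m≤n = begin
      lookupℕ (Ptab g) m                  ≡⟨ lookupℕ-tabulate (λ i → entry g i (fromℕ n)) m≤n ⟩
      entry g (fromℕ< (s≤s m≤n)) (fromℕ n) ≡⟨ entry≡gridℕ g (Finₚ.toℕ-fromℕ< (s≤s m≤n)) (Finₚ.toℕ-fromℕ n) ⟩
      gridℕ g m n                         ≡⟨ diagonal m≤n ℕₚ.≤-refl ⟩
      gridℕ g (m ⊓ n) (m ⊓ n)             ≡⟨ cong (λ k → gridℕ g k k) (ℕₚ.m≤n⇒m⊓n≡m m≤n) ⟩
      gridℕ g m m                         ∎
      where open ≡-Reasoning

    lookup-Ptab : ∀ i → lookup (Ptab g) i ≡ gridℕ g (toℕ i) (toℕ i)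
    lookup-Ptab i = trans (lookup≡lookupℕ (Ptab g) i) (lookupℕ-Ptab (Finₚ.toℕ≤pred[n] i))

    entry≡entry-gridOf-Ptab : ∀ i j → entry g i j ≡ entry (gridOf (Ptab g)) i j
    entry≡entry-gridOf-Ptab i j = begin
      entry g i j                  ≡⟨ entry≡gridℕ g refl refl ⟩
      gridℕ g (toℕ i) (toℕ j)      ≡⟨ diagonal (Finₚ.toℕ≤pred[n] i) (Finₚ.toℕ≤pred[n] j) ⟩
      gridℕ g m m                  ≡⟨ lookupℕ-Ptab (ℕₚ.≤-trans (ℕₚ.m⊓n≤m (toℕ i) (toℕ j)) (Finₚ.toℕ≤pred[n] i)) ⟨
      lookupℕ (Ptab g) m           ≡⟨ entry-gridOf (Ptab g) i j ⟨
      entry (gridOf (Ptab g)) i j  ∎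
      where open ≡-Reasoning
            m : ℕ
            m = toℕ i ⊓ toℕ j

  growth-Qtab≡Ptab : Qtab g ≡ Ptab g
  growth-Qtab≡Ptab = lookup-extensionality λ i → begin
    lookup (Qtab g) i                 ≡⟨ Vecₚ.lookup∘tabulate (entry g (fromℕ n)) i ⟩
    entry g (fromℕ n) i               ≡⟨ entry≡gridℕ g (Finₚ.toℕ-fromℕ n) refl ⟩
    gridℕ g n (toℕ i)                 ≡⟨ diagonal ℕₚ.≤-refl (Finₚ.toℕ≤pred[n] i) ⟩
    gridℕ g (n ⊓ toℕ i) (n ⊓ toℕ i)   ≡⟨ cong (λ m → gridℕ g m m) (ℕₚ.m≥n⇒m⊓n≡n (Finₚ.toℕ≤pred[n] i)) ⟩
    gridℕ g (toℕ i) (toℕ i)           ≡⟨ lookup-Ptab i ⟨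
    lookup (Ptab g) i                 ∎
    where open ≡-Reasoning

  growth≡gridOf-Ptab : g ≡ gridOf (Ptab g)
  growth≡gridOf-Ptab =
    lookup-extensionality λ i → lookup-extensionality (entry≡entry-gridOf-Ptab i)

-- The weight of the growth of a tableau

squareWeight-ρ≢λ : ∀ q t μ {ρ λ′} ν → ρ ≢ λ′ → squareWeight q t μ ρ λ′ ν ≡ 1ℚ
squareWeight-ρ≢λ q t μ ν ρ≢λ rewrite ==-≢ ρ≢λ = refl

squareWeight-ν≡λ : ∀ q t μ ρ λ′ → squareWeight q t μ ρ λ′ λ′ ≡ 1ℚ
squareWeight-ν≡λ q t μ ρ λ′ rewrite ==-refl λ′ | ∧-zeroʳ (ρ == λ′) = refl

squareWeight-μ≡ρ≡λ : ∀ q t λ′ {ν} → ν ≢ λ′ →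
                     squareWeight q t λ′ λ′ λ′ ν ≡ zpow t (nskew ν λ′) * alpha q t λ′ ν
squareWeight-μ≡ρ≡λ q t λ′ ν≢λ rewrite ==-refl λ′ | ==-≢ ν≢λ = refl

chainWeight : ∀ {n} → ℚ → ℚ → Chain n → ℚ
chainWeight {n} q t P =
  pow t (nfun (shape P))
  * prodℚ (map (λ (i : Fin n) → alpha q t (lookup P (inject₁ i)) (lookup P (Fin.suc i))) (finList n))

module _ {n : ℕ} {P : Chain n} (syt : IsSYT P) (q t : ℚ) where
  private
    p : ℕ → List ℕ
    p = lookupℕ P

    squareAt : ℕ → ℕ → ℚ
    squareAt a b = squareWeight q t (p (a ⊓ b)) (p (a ⊓ suc b)) (p (suc a ⊓ b)) (p (suc a ⊓ suc b))

    tStep αStep : ℕ → ℚ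
    tStep a = zpow t (nskew (p (suc a)) (p a))
    αStep a = alpha q t (p a) (p (suc a))

    squareAt-≡ : ∀ {a b μ ρ λ′ ν} → a ⊓ b ≡ μ → a ⊓ suc b ≡ ρ → suc a ⊓ b ≡ λ′ → suc a ⊓ suc b ≡ ν →
                 squareAt a b ≡ squareWeight q t (p μ) (p ρ) (p λ′) (p ν)
    squareAt-≡ refl refl refl refl = refl

    squareAt-diagonal : ∀ {a} → a < n → squareAt a a ≡ tStep a * αStep a
    squareAt-diagonal {a} a<n = trans
      (squareAt-≡ (ℕₚ.⊓-idem a) (ℕₚ.m≤n⇒m⊓n≡m (ℕₚ.n≤1+n a)) (ℕₚ.m≥n⇒m⊓n≡n (ℕₚ.n≤1+n a)) (ℕₚ.⊓-idem (suc a)))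
      (squareWeight-μ≡ρ≡λ q t (p a) (syt-suc-≢ {P = P} syt a<n))

    squareAt-off-diagonal : ∀ {a b} → a < n → b ≢ a → squareAt a b ≡ 1ℚ
    squareAt-off-diagonal {a} {b} a<n b≢a with ℕₚ.<-cmp a b
    ... | tri≈ _ a≡b _ = ⊥-elim (b≢a (sym a≡b))
    ... | tri< a<b _ _ = let a≤b = ℕₚ.<⇒≤ a<b in trans
      (squareAt-≡ (ℕₚ.m≤n⇒m⊓n≡m a≤b) (ℕₚ.m≤n⇒m⊓n≡m (ℕₚ.m≤n⇒m≤1+n a≤b))
                  (ℕₚ.m≤n⇒m⊓n≡m a<b) (ℕₚ.m≤n⇒m⊓n≡m (s≤s a≤b)))
      (squareWeight-ν≡λ q t (p a) (p a) (p (suc a)))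
    ... | tri> _ _ b<a = let b≤a = ℕₚ.<⇒≤ b<a in trans
      (squareAt-≡ (ℕₚ.m≥n⇒m⊓n≡n b≤a) (ℕₚ.m≥n⇒m⊓n≡n b<a)
                  (ℕₚ.m≥n⇒m⊓n≡n (ℕₚ.m≤n⇒m≤1+n b≤a)) (ℕₚ.m≥n⇒m⊓n≡n (s≤s b≤a)))
      (squareWeight-ρ≢λ q t (p b) (p (suc b)) (syt-suc-≢ {P = P} syt (ℕₚ.<-trans b<a a<n)))

    square-gridOf : ∀ (i j : Fin n) →
      squareWeight q t (entry (gridOf P) (inject₁ i) (inject₁ j)) (entry (gridOf P) (inject₁ i) (Fin.suc j))
                       (entry (gridOf P) (Fin.suc i) (inject₁ j)) (entry (gridOf P) (Fin.suc i) (Fin.suc j))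
      ≡ squareAt (toℕ i) (toℕ j)
    square-gridOf i j
      rewrite entry-gridOf P (inject₁ i) (inject₁ j) | entry-gridOf P (inject₁ i) (Fin.suc j)
            | entry-gridOf P (Fin.suc i) (inject₁ j) | entry-gridOf P (Fin.suc i) (Fin.suc j)
            | Finₚ.toℕ-inject₁ i | Finₚ.toℕ-inject₁ j = refl

    weight-gridOf-steps : weight q t (gridOf P) ≡ prodℚ (applyUpTo (λ a → tStep a * αStep a) n)
    weight-gridOf-steps = trans (prodℚ-concatMap _ (finList n)) (cong prodℚ (map-finList _ _ row≡diagonal))
      where
      row≡diagonal : ∀ i → prodℚ (map (λ j → _) (finList n)) ≡ tStep (toℕ i) * αStep (toℕ i)
      row≡diagonal i = begin
        prodℚ (map _ (finList n))                ≡⟨ cong prodℚ (map-finList _ (squareAt (toℕ i)) (square-gridOf i)) ⟩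
        prodℚ (applyUpTo (squareAt (toℕ i)) n)   ≡⟨ prodℚ-applyUpTo-single n _ (toℕ i) (Finₚ.toℕ<n i)
                                                      (λ b _ b≢i → squareAt-off-diagonal (Finₚ.toℕ<n i) b≢i) ⟩
        squareAt (toℕ i) (toℕ i)                 ≡⟨ squareAt-diagonal (Finₚ.toℕ<n i) ⟩
        tStep (toℕ i) * αStep (toℕ i)            ∎
        where open ≡-Reasoning

  weight-gridOf : t ≢ 0ℚ → weight q t (gridOf P) ≡ chainWeight q t P
  weight-gridOf t≢0 = begin
    weight q t (gridOf P)                                   ≡⟨ weight-gridOf-steps ⟩
    prodℚ (applyUpTo (λ a → tStep a * αStep a) n)           ≡⟨ prodℚ-applyUpTo-* n tStep αStep ⟩
    prodℚ (applyUpTo tStep n) * prodℚ (applyUpTo αStep n)   ≡⟨ cong₂ _*_ tSteps αSteps ⟩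
    chainWeight q t P                                       ∎
    where
    open ≡-Reasoning
    tSteps : prodℚ (applyUpTo tStep n) ≡ pow t (nfun (shape P))
    tSteps = begin
      Πt                                 ≡⟨ ℚₚ.*-identityʳ Πt ⟨
      Πt * pow t (nfun [])               ≡⟨ cong (λ κ → Πt * pow t (nfun κ)) (syt-zero {P = P} syt) ⟨
      Πt * pow t (nfun (p 0))            ≡⟨ prodℚ-telescope n (nfun ∘ p) t≢0 ⟩
      pow t (nfun (p n))                 ≡⟨ cong (pow t ∘ nfun ∘ p) (Finₚ.toℕ-fromℕ n) ⟨
      pow t (nfun (p (toℕ (fromℕ n))))   ≡⟨ cong (pow t ∘ nfun) (lookup≡lookupℕ P (fromℕ n)) ⟨
      pow t (nfun (shape P))             ∎
      where Πt : ℚ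
            Πt = prodℚ (applyUpTo tStep n)
    αSteps : prodℚ (applyUpTo αStep n)
             ≡ prodℚ (map (λ i → alpha q t (lookup P (inject₁ i)) (lookup P (Fin.suc i))) (finList n))
    αSteps = sym (cong prodℚ (map-finList _ αStep λ i → cong₂ (alpha q t)
      (trans (lookup≡lookupℕ P (inject₁ i)) (cong p (Finₚ.toℕ-inject₁ i)))
      (lookup≡lookupℕ P (Fin.suc i))))

unique-singleton : ∀ {A : Set} {x : A} {xs} → Unique xs → (∀ {y} → y ∈ xs → y ≡ x) → x ∈ xs → xs ≡ [ x ]
unique-singleton {xs = y ∷ []}     _                   all≡x _ = cong [_] (all≡x (here refl))
unique-singleton {xs = y ∷ z ∷ zs} ((y≢z ∷ _) ∷ _) all≡x _ =
  ⊥-elim (y≢z (trans (all≡x (here refl)) (sym (all≡x (there (here refl))))))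

matches : ∀ {n} → Chain n → Chain n → Grid n → Bool
matches P Q g = chainEq (Ptab g) P ∧ chainEq (Qtab g) Q

matchingGrowths : ∀ {n} → Chain n → Chain n → List (Grid n)
matchingGrowths {n} P Q = filterᵇ (matches P Q) (growths (idPerm n))

∈-matchingGrowths⁻ : ∀ {n} (P Q : Chain n) {g} → g ∈ matchingGrowths P Q → P ≡ Q × g ≡ gridOf P
∈-matchingGrowths⁻ {n} P Q {g} g∈ = trans (sym Ptab≡P) (trans (sym (growth-Qtab≡Ptab g∈growths)) Qtab≡Q)
                                   , trans (growth≡gridOf-Ptab g∈growths) (cong gridOf Ptab≡P)
  where
  membership : g ∈ growths (idPerm n) × T (matches P Q g)
  membership = ∈ₚ.∈-filter⁻ (T? ∘ matches P Q) {xs = growths (idPerm n)} g∈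
  g∈growths : g ∈ growths (idPerm n)
  g∈growths = proj₁ membership
  g-matches : T (matches P Q g)
  g-matches = proj₂ membership
  Ptab≡P : Ptab g ≡ P
  Ptab≡P = chainEq⇒≡ (proj₁ (T-∧⁻ g-matches))
  Qtab≡Q : Qtab g ≡ Q
  Qtab≡Q = chainEq⇒≡ (proj₂ (T-∧⁻ {chainEq (Ptab g) P} g-matches))

matchingGrowths-≢ : ∀ {n} {P Q : Chain n} → P ≢ Q → matchingGrowths P Q ≡ []
matchingGrowths-≢ {n} {P} {Q} P≢Q =
  Listₚ.filter-none (T? ∘ matches P Q) {growths (idPerm n)} (All.tabulate λ g∈ g-matches →
    P≢Q (proj₁ (∈-matchingGrowths⁻ P Q (∈ₚ.∈-filter⁺ (T? ∘ matches P Q) g∈ g-matches))))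

matchingGrowths-diagonal : ∀ {n} {P : Chain n} → IsSYT P → matchingGrowths P P ≡ [ gridOf P ]
matchingGrowths-diagonal {n} {P} syt = unique-singleton
  (Uniqueₚ.filter⁺ (T? ∘ matches P P) (growths-unique (idPerm n)))
  (proj₂ ∘ ∈-matchingGrowths⁻ P P)
  (∈ₚ.∈-filter⁺ (T? ∘ matches P P) (gridOf-∈-growths {P = P} syt)
    (subst₂ (λ U V → T (chainEq U P ∧ chainEq V P)) (sym (Ptab-gridOf P)) (sym (Qtab-gridOf P))
            (T-∧⁺ (chainEq-refl P) (chainEq-refl P))))

lemma4p28 : (n : ℕ) (P Q : Chain n) → IsSYT P → IsSYT Q → shape P ≡ shape Q →
            (q t : ℚ) → Generic q t →
            (P ≡ Q → Prob q t (idPerm n) P Q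
                       ≡ pow t (nfun (shape P))
                         * prodℚ (map (λ (i : Fin n) → alpha q t (lookup P (inject₁ i)) (lookup P (Fin.suc i))) (finList n)))
            × (P ≢ Q → Prob q t (idPerm n) P Q ≡ 0ℚ)
lemma4p28 n P Q sytP _ _ q t (_ , t≢0 , _) = diagonal , off-diagonal
  where
  diagonal : P ≡ Q → Prob q t (idPerm n) P Q ≡ chainWeight q t P
  diagonal refl = begin
    Prob q t (idPerm n) P P      ≡⟨ cong (sumℚ ∘ map (weight q t)) (matchingGrowths-diagonal {P = P} sytP) ⟩
    weight q t (gridOf P) ℚ.+ 0ℚ ≡⟨ ℚₚ.+-identityʳ (weight q t (gridOf P)) ⟩
    weight q t (gridOf P)        ≡⟨ weight-gridOf {P = P} sytP q t t≢0 ⟩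
    chainWeight q t P            ∎
    where open ≡-Reasoning

  off-diagonal : P ≢ Q → Prob q t (idPerm n) P Q ≡ 0ℚ
  off-diagonal P≢Q = cong (sumℚ ∘ map (weight q t)) (matchingGrowths-≢ P≢Q)
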